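{- A graph $G=(V,E)$ has threshold-width at most $k$ if and only if there exist $k$ independent sets $\mathbb{N}_1,\dots,\mathbb{N}_k$ of $G$ such that for every nonempty $W \subseteq V$, the induced subgraph $G[W]$ has an isolated vertex or has a vertex $\omega \in W$ such that for every $y \in W \setminus \{\omega\}$, either $\omega$ is adjacent to $y$ or there exists $i \in \{1,\dots,k\}$ with $\{\omega,y\} \subseteq \mathbb{N}_i$.
   Context: A graph is a threshold graph if it has no induced subgraph isomorphic to $P_4$, $C_4$ or $2K_2$. For independent sets $\mathbb{N}_1,\dots,\mathbb{N}_k$ of $G$ (not necessarily disjoint), an embedding of $G$ with respect to them is a graph $H=(V,F)$ with $E \subseteq F$ such that every edge of $F \setminus E$ has both endpoints in some $\mathbb{N}_i$. The threshold-width of $G$ is the minimum $k$ such that there exist $k$ independent sets of $G$ and an embedding of $G$ with respect to them which is a threshold graph. -}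

module Defs where

open import Data.Nat using (ℕ; _≤_)
open import Data.Bool using (Bool; true; false)
open import Data.Fin using (Fin; zero; suc)
open import Data.Fin.Subset using (Subset; _∈_; Nonempty)
open import Data.Product using (Σ; ∃; ∃-syntax; _×_)
open import Data.Sum using (_⊎_)
open import Relation.Nullary using (¬_)
open import Relation.Binary.PropositionalEquality using (_≡_; _≢_)
open import Function.Definitions using (Injective)

record Graph (n : ℕ) : Set where
  field
    adj    : Fin n → Fin n → Bool
    symm   : ∀ u v → adj u v ≡ adj v u
    irrefl : ∀ v → adj v v ≡ false
open Graph public

Edge : ∀ {n} → Graph n → Fin n → Fin n → Set
Edge G u v = adj G u v ≡ true

Independent : ∀ {n} → Graph n → Subset n → Set
Independent G S = ∀ u v → u ∈ S → v ∈ S → ¬ Edge G u v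

P4adj : Fin 4 → Fin 4 → Bool
P4adj zero (suc zero) = true
P4adj (suc zero) zero = true
P4adj (suc zero) (suc (suc zero)) = true
P4adj (suc (suc zero)) (suc zero) = true
P4adj (suc (suc zero)) (suc (suc (suc zero))) = true
P4adj (suc (suc (suc zero))) (suc (suc zero)) = true
P4adj _ _ = false

C4adj : Fin 4 → Fin 4 → Bool
C4adj zero (suc (suc (suc zero))) = true
C4adj (suc (suc (suc zero))) zero = true
C4adj i j = P4adj i j

2K2adj : Fin 4 → Fin 4 → Bool
2K2adj zero (suc zero) = true
2K2adj (suc zero) zero = true
2K2adj (suc (suc zero)) (suc (suc (suc zero))) = true
2K2adj (suc (suc (suc zero))) (suc (suc zero)) = true
2K2adj _ _ = false

HasInduced4 : ∀ {n} → Graph n → (Fin 4 → Fin 4 → Bool) → Set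
HasInduced4 G p = Σ (Fin 4 → Fin _) λ f →
  Injective _≡_ _≡_ f × (∀ i j → adj G (f i) (f j) ≡ p i j)

IsThreshold : ∀ {n} → Graph n → Set
IsThreshold G = ¬ HasInduced4 G P4adj × ¬ HasInduced4 G C4adj × ¬ HasInduced4 G 2K2adj

IsEmbedding : ∀ {n k} → Graph n → (Fin k → Subset n) → Graph n → Set
IsEmbedding G N H =
  (∀ u v → Edge G u v → Edge H u v) ×
  (∀ u v → Edge H u v → ¬ Edge G u v → ∃[ i ] (u ∈ N i × v ∈ N i))

HasThresholdEmbedding : ∀ {n} → Graph n → ℕ → Set
HasThresholdEmbedding {n} G k =
  Σ (Fin k → Subset n) λ N → (∀ i → Independent G (N i)) ×
    Σ (Graph n) λ H → IsEmbedding G N H × IsThreshold H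

ThresholdWidth≤ : ∀ {n} → Graph n → ℕ → Set
ThresholdWidth≤ G k = ∃[ j ] (j ≤ k × HasThresholdEmbedding G j)

module Submission where

-- A graph is threshold iff every nonempty vertex set S induces a subgraph with an isolated or a
-- dominating vertex: P4, C4 and 2K2 have neither, and conversely, without these patterns the
-- vicinal preorder (N(u) ∩ S ⊆ N[w]) is total on S, so a greatest vertex either dominates S or
-- each of its non-neighbours is isolated in S.
-- Given a threshold embedding H, isolated vertices of H[W] are isolated in G[W], and edges of H
-- are edges of G or lie inside some Nᵢ, which yields the condition. Conversely, H is built by
-- peeling off the vertex ω supplied by the condition for the remaining set W: ω keeps its G-edges,
-- and if it dominates W modulo the Nᵢ it is joined to all of W; then the first peeled vertex of
-- any S is isolated or dominating in H[S].

open import Defs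
open import Data.Nat using (ℕ; _≤_; _+_)
open import Data.Nat.Properties using (≤-refl; m≤n⇒∃[o]m+o≡n)
open import Data.Bool using (Bool; true; false; _∨_)
import Data.Bool.Properties as Bool
open import Data.Fin using (Fin; _≟_; splitAt; _↑ˡ_)
open import Data.Fin.Patterns using (0F; 1F; 2F; 3F)
open import Data.Fin.Properties using (any?; all?; splitAt-↑ˡ)
open import Data.Fin.Subset using (Subset; _∈_; _⊆_; Nonempty; _-_; ⊤; ⊥; _⊂_)
open import Data.Fin.Subset.Properties using (_∈?_; nonempty?; ∈⊤; ∉⊥; x∈p∧x≢y⇒x∈p-y; x∈p⇒p-x⊂p)
open import Data.Fin.Subset.Induction using (⊂-wellFounded)
open import Data.List using ([]; _∷_; allFin)
open import Data.List.Relation.Unary.All as All using (All; []; _∷_)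
open import Data.List.Membership.Propositional.Properties using (∈-allFin)
open import Data.Vec using (Vec; []; _∷_; lookup; tabulate)
open import Data.Vec.Properties using (lookup∘tabulate; []=⇒lookup; lookup⇒[]=)
open import Data.Vec.Relation.Unary.All using ([]; _∷_)
open import Data.Vec.Relation.Unary.AllPairs using ([]; _∷_)
open import Data.Vec.Relation.Unary.Unique.Propositional using (Unique)
open import Data.Vec.Relation.Unary.Unique.Propositional.Properties using (lookup-injective)
open import Data.Product using (Σ; ∃; ∃-syntax; _×_; _,_; proj₁; proj₂)
open import Data.Sum using (_⊎_; inj₁; inj₂; [_,_]′)
import Data.Sum as Sum
open import Function using (const; _∘_)
open import Function.Bundles using (_⇔_; mk⇔)
open import Induction.WellFounded using (WfRec; module All)
open import Relation.Nullary using (¬_; Dec; yes; no; does; contradiction; ¬?)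
open import Relation.Nullary.Decidable using (_×-dec_; _⊎-dec_; decidable-stable; dec-true; toWitness)
open import Level using (0ℓ)
open import Relation.Unary using (Pred; Decidable)
open import Relation.Binary.PropositionalEquality

all⊎counterexample : ∀ {n} {P Q : Pred (Fin n) 0ℓ} → Decidable P → Decidable Q →
  (∀ x → P x → Q x) ⊎ ∃[ x ] (P x × ¬ Q x)
all⊎counterexample P? Q? with any? (λ x → P? x ×-dec ¬? (Q? x))
... | yes counterexample = inj₂ counterexample
... | no ¬counterexample =
  inj₁ λ x px → decidable-stable (Q? x) (λ ¬qx → ¬counterexample (x , px , ¬qx))

module _ {n} {P : Pred (Fin n) 0ℓ} (P? : Decidable P) (_≼_ : Fin n → Fin n → Set)
         (≼-refl : ∀ x → x ≼ x)
         (≼-trans : ∀ {x y z} → P x → P z → x ≼ y → y ≼ z → x ≼ z)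
         (≼-total : ∀ x y → x ≼ y ⊎ y ≼ x) where

  greatestAmong : ∀ xs {x} → P x → ∃[ v ] (P v × All (λ y → P y → y ≼ v) xs)
  greatestAmong [] {x} px = x , px , []
  greatestAmong (y ∷ ys) px with greatestAmong ys px
  ... | v , pv , below with P? y
  ...   | no ¬py = v , pv , (λ py → contradiction py ¬py) ∷ below
  ...   | yes py with ≼-total y v
  ...     | inj₁ y≼v = v , pv , const y≼v ∷ below
  ...     | inj₂ v≼y = y , py , const (≼-refl y)
                           ∷ All.map (λ z≼v pz → ≼-trans pz py (z≼v pz) v≼y) below

  greatest : ∃ P → ∃[ v ] (P v × ∀ y → P y → y ≼ v)
  greatest (x , px) with greatestAmong (allFin n) px
  ... | v , pv , below = v , pv , λ y → All.lookup below (∈-allFin y)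

module _ {n : ℕ} where

  Isolated : (Fin n → Fin n → Set) → Subset n → Fin n → Set
  Isolated _~_ W v = ∀ u → u ∈ W → ¬ v ~ u

  Dominating : (Fin n → Fin n → Set) → Subset n → Fin n → Set
  Dominating _~_ W ω = ∀ y → y ∈ W → y ≢ ω → ω ~ y

  IsolatedOrDominating : (_~_ _≈_ : Fin n → Fin n → Set) → Subset n → Set
  IsolatedOrDominating _~_ _≈_ W =
    (∃[ v ] (v ∈ W × Isolated _~_ W v)) ⊎ (∃[ ω ] (ω ∈ W × Dominating _≈_ W ω))

  isolatedOrDominating-mono : ∀ {_~_ _~′_ _≈_ _≈′_ W} →
    (∀ {u v} → u ∈ W → v ∈ W → u ~′ v → u ~ v) →
    (∀ {u v} → u ∈ W → v ∈ W → u ≈ v → u ≈′ v) →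
    IsolatedOrDominating _~_ _≈_ W → IsolatedOrDominating _~′_ _≈′_ W
  isolatedOrDominating-mono ~′⇒~ ≈⇒≈′ (inj₁ (v , vW , iso)) =
    inj₁ (v , vW , λ u uW v~′u → iso u uW (~′⇒~ vW uW v~′u))
  isolatedOrDominating-mono ~′⇒~ ≈⇒≈′ (inj₂ (ω , ωW , dom)) =
    inj₂ (ω , ωW , λ y yW y≢ω → ≈⇒≈′ ωW yW (dom y yW y≢ω))

  HereditarilyIsolatedOrDominating : Graph n → Subset n → Set
  HereditarilyIsolatedOrDominating H W =
    ∀ S → S ⊆ W → Nonempty S → IsolatedOrDominating (Edge H) (Edge H) S

  Shared : ∀ {k} → (Fin k → Subset n) → Fin n → Fin n → Set
  Shared N u v = ∃[ i ] (u ∈ N i × v ∈ N i)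

  shared-sym : ∀ {k} {N : Fin k → Subset n} {u v} → Shared N u v → Shared N v u
  shared-sym (i , u∈ , v∈) = i , v∈ , u∈

  IsolatedOrDominatingModulo : ∀ {k} → Graph n → (Fin k → Subset n) → Set
  IsolatedOrDominatingModulo G N =
    ∀ W → Nonempty W → IsolatedOrDominating (Edge G) (λ u v → Edge G u v ⊎ Shared N u v) W

module _ {n} (H : Graph n) where

  edge? : ∀ u v → Dec (Edge H u v)
  edge? u v = adj H u v Bool.≟ true

  adj-flip : ∀ {u v b} → adj H u v ≡ b → adj H v u ≡ b
  adj-flip {u} {v} e = trans (symm H v u) e

  nonEdge : ∀ {u v} → ¬ Edge H u v → adj H u v ≡ false
  nonEdge = Bool.¬-not

  edge⇒≢ : ∀ {u v} → Edge H u v → u ≢ v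
  edge⇒≢ {u} e refl = contradiction (trans (sym e) (irrefl H u)) λ ()

UpperTriangle : (Fin 4 → Fin 4 → Set) → Set
UpperTriangle P = P 0F 1F × P 0F 2F × P 0F 3F × P 1F 2F × P 1F 3F × P 2F 3F

fromUpperTriangle : ∀ {P : Fin 4 → Fin 4 → Set} →
  (∀ {i j} → P i j → P j i) → (∀ i → P i i) → UpperTriangle P → ∀ i j → P i j
fromUpperTriangle flip diag (p01 , p02 , p03 , p12 , p13 , p23) = λ where
  0F 0F → diag 0F ; 0F 1F → p01      ; 0F 2F → p02      ; 0F 3F → p03
  1F 0F → flip p01 ; 1F 1F → diag 1F ; 1F 2F → p12      ; 1F 3F → p13
  2F 0F → flip p02 ; 2F 1F → flip p12 ; 2F 2F → diag 2F ; 2F 3F → p23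
  3F 0F → flip p03 ; 3F 1F → flip p13 ; 3F 2F → flip p23 ; 3F 3F → diag 3F

module _ {m} (p : Fin m → Fin m → Bool) where

  SimplePattern : Set
  SimplePattern = (∀ i j → p i j ≡ p j i) × (∀ i → p i i ≡ false)

  simplePattern? : Dec SimplePattern
  simplePattern? = all? (λ i → all? λ j → p i j Bool.≟ p j i) ×-dec all? (λ i → p i i Bool.≟ false)

  NoIsolatedNorDominating : Set
  NoIsolatedNorDominating = ∀ i → (∃[ j ] p i j ≡ true) × (∃[ j ] (j ≢ i × p i j ≡ false))

  noIsolatedNorDominating? : Dec NoIsolatedNorDominating
  noIsolatedNorDominating? = all? λ i →
    any? (λ j → p i j Bool.≟ true) ×-dec any? (λ j → ¬? (j ≟ i) ×-dec (p i j Bool.≟ false))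

induced4 : ∀ {n} (H : Graph n) {p} → SimplePattern p → (xs : Vec (Fin n) 4) → Unique xs →
  UpperTriangle (λ i j → adj H (lookup xs i) (lookup xs j) ≡ p i j) → HasInduced4 H p
induced4 H (p-sym , p-irr) xs distinct upper =
  lookup xs , lookup-injective distinct _ _ ,
  fromUpperTriangle (λ {i} {j} e → trans (adj-flip H e) (p-sym i j))
                    (λ i → trans (irrefl H _) (sym (p-irr i))) upper

module _ {m n} (f : Fin m → Fin n) where

  image : Subset n
  image = tabulate λ v → does (any? λ i → f i ≟ v)

  image⁺ : ∀ i → f i ∈ image
  image⁺ i = lookup⇒[]= (f i) image
    (trans (lookup∘tabulate _ (f i)) (dec-true (any? λ j → f j ≟ f i) (i , refl)))

  image⁻ : ∀ {v} → v ∈ image → ∃[ i ] f i ≡ v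
  image⁻ {v} v∈ with any? (λ i → f i ≟ v) | trans (sym (lookup∘tabulate _ v)) ([]=⇒lookup v∈)
  ... | yes found | _ = found
  ... | no _      | ()

module _ {n} (H : Graph n) (hereditary : HereditarilyIsolatedOrDominating H ⊤) where

  notInduced : ∀ {p} → NoIsolatedNorDominating p → ¬ HasInduced4 H p
  notInduced neither (f , f-inj , f-adj)
    with hereditary (image f) (λ _ → ∈⊤) (f 0F , image⁺ f 0F)
  ... | inj₁ (s , s∈ , iso) with image⁻ f s∈
  ...   | i , refl with neither i
  ...     | (j , pij) , _ = iso (f j) (image⁺ f j) (trans (f-adj i j) pij)
  notInduced neither (f , f-inj , f-adj) | inj₂ (s , s∈ , dom) with image⁻ f s∈
  ...   | i , refl with neither i
  ...     | _ , (j , j≢i , pij) = contradiction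
              (trans (sym (dom (f j) (image⁺ f j) (j≢i ∘ f-inj))) (trans (f-adj i j) pij)) λ ()

  hereditarilyIsolatedOrDominating⇒threshold : IsThreshold H
  hereditarilyIsolatedOrDominating⇒threshold =
      notInduced (toWitness {a? = noIsolatedNorDominating? P4adj} _)
    , notInduced (toWitness {a? = noIsolatedNorDominating? C4adj} _)
    , notInduced (toWitness {a? = noIsolatedNorDominating? 2K2adj} _)

module _ {n} (H : Graph n) where

  VicinalBelow : Subset n → Fin n → Fin n → Set
  VicinalBelow S u w = ∀ a → a ∈ S → Edge H u a → a ≡ w ⊎ Edge H w a

  vicinal-refl : ∀ S u → VicinalBelow S u u
  vicinal-refl S u a _ = inj₂

  vicinal-trans : ∀ {S u w x} → u ∈ S → x ∈ S →
    VicinalBelow S u w → VicinalBelow S w x → VicinalBelow S u x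
  vicinal-trans {u = u} {x = x} uS xS u≼w w≼x a aS ua with u≼w a aS ua
  ... | inj₂ wa = w≼x a aS wa
  ... | inj₁ refl with w≼x u uS (adj-flip H ua)
  ...   | inj₁ refl = inj₂ ua
  ...   | inj₂ xu with u≼w x xS (adj-flip H xu)
  ...     | inj₁ refl = inj₁ refl
  ...     | inj₂ ax = inj₂ (adj-flip H ax)

  vicinal⊎counterexample : ∀ S u w →
    VicinalBelow S u w ⊎ ∃[ a ] (a ∈ S × Edge H u a × a ≢ w × ¬ Edge H w a)
  vicinal⊎counterexample S u w
    with all⊎counterexample (λ a → (a ∈? S) ×-dec edge? H u a) (λ a → (a ≟ w) ⊎-dec edge? H w a)
  ... | inj₁ below = inj₁ λ a aS ua → below a (aS , ua)
  ... | inj₂ (a , (aS , ua) , ¬below) = inj₂ (a , aS , ua , ¬below ∘ inj₁ , ¬below ∘ inj₂)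

  nonNeighbourOfGreatest-isolated : ∀ {S v y} → (∀ z → z ∈ S → VicinalBelow S z v) →
    y ∈ S → y ≢ v → ¬ Edge H v y → Isolated (Edge H) S y
  nonNeighbourOfGreatest-isolated {y = y} greatest yS y≢v ¬vy z zS yz with greatest y yS z zS yz
  ... | inj₁ refl = ¬vy (adj-flip H yz)
  ... | inj₂ vz with greatest z zS y yS (adj-flip H yz)
  ...   | inj₁ y≡v = y≢v y≡v
  ...   | inj₂ vy = ¬vy vy

module _ {n} (H : Graph n) (threshold : IsThreshold H) where

  vicinal-total : ∀ S u w → VicinalBelow H S u w ⊎ VicinalBelow H S w u
  vicinal-total S u w with vicinal⊎counterexample H S u w | vicinal⊎counterexample H S w u
  ... | inj₁ u≼w | _ = inj₁ u≼w
  ... | inj₂ _ | inj₁ w≼u = inj₂ w≼u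
  vicinal-total S u w | inj₂ (a , _ , ua , a≢w , ¬wa) | inj₂ (b , _ , wb , b≢u , ¬ub) =
    contradiction threshold (noInducedPattern (edge? H u w) (edge? H a b))
    where
    u≢a : u ≢ a
    u≢a = edge⇒≢ H ua
    w≢b : w ≢ b
    w≢b = edge⇒≢ H wb
    u≢w : u ≢ w
    u≢w refl = ¬wa ua
    a≢b : a ≢ b
    a≢b refl = ¬ub ua
    au : Edge H a u
    au = adj-flip H ua
    aw : adj H a w ≡ false
    aw = adj-flip H (nonEdge H ¬wa)
    ub : adj H u b ≡ false
    ub = nonEdge H ¬ub
    bw : Edge H b w
    bw = adj-flip H wb

    -- The witnesses a, b of incomparability span a C4, P4 or 2K2 according to the edges uw and ab.

    noInducedPattern : Dec (Edge H u w) → Dec (Edge H a b) → ¬ IsThreshold H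
    noInducedPattern (yes uw) (yes ab) (_ , noC4 , _) =
      noC4 (induced4 H (toWitness {a? = simplePattern? C4adj} _) (a ∷ u ∷ w ∷ b ∷ [])
        ((≢-sym u≢a ∷ a≢w ∷ a≢b ∷ []) ∷ (u≢w ∷ ≢-sym b≢u ∷ []) ∷ (w≢b ∷ []) ∷ [] ∷ [])
        (au , aw , ab , uw , ub , wb))
    noInducedPattern (yes uw) (no ¬ab) (noP4 , _ , _) =
      noP4 (induced4 H (toWitness {a? = simplePattern? P4adj} _) (a ∷ u ∷ w ∷ b ∷ [])
        ((≢-sym u≢a ∷ a≢w ∷ a≢b ∷ []) ∷ (u≢w ∷ ≢-sym b≢u ∷ []) ∷ (w≢b ∷ []) ∷ [] ∷ [])
        (au , aw , nonEdge H ¬ab , uw , ub , wb))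
    noInducedPattern (no ¬uw) (yes ab) (noP4 , _ , _) =
      noP4 (induced4 H (toWitness {a? = simplePattern? P4adj} _) (u ∷ a ∷ b ∷ w ∷ [])
        ((u≢a ∷ ≢-sym b≢u ∷ u≢w ∷ []) ∷ (a≢b ∷ a≢w ∷ []) ∷ (≢-sym w≢b ∷ []) ∷ [] ∷ [])
        (ua , ub , nonEdge H ¬uw , ab , aw , bw))
    noInducedPattern (no ¬uw) (no ¬ab) (_ , _ , no2K2) =
      no2K2 (induced4 H (toWitness {a? = simplePattern? 2K2adj} _) (u ∷ a ∷ w ∷ b ∷ [])
        ((u≢a ∷ u≢w ∷ ≢-sym b≢u ∷ []) ∷ (a≢w ∷ a≢b ∷ []) ∷ (w≢b ∷ []) ∷ [] ∷ [])
        (ua , nonEdge H ¬uw , ub , aw , nonEdge H ¬ab , wb))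

  threshold⇒hereditarilyIsolatedOrDominating : HereditarilyIsolatedOrDominating H ⊤
  threshold⇒hereditarilyIsolatedOrDominating S _ nonempty
    with greatest (_∈? S) (VicinalBelow H S) (vicinal-refl H S) (vicinal-trans H) (vicinal-total S) nonempty
  ... | v , vS , top with all⊎counterexample (λ y → (y ∈? S) ×-dec ¬? (y ≟ v)) (edge? H v)
  ...   | inj₁ dom = inj₂ (v , vS , λ y yS y≢v → dom y (yS , y≢v))
  ...   | inj₂ (y , (yS , y≢v) , ¬vy) =
    inj₁ (y , yS , nonNeighbourOfGreatest-isolated H top yS y≢v ¬vy)

touches : ∀ {n} (x u v : Fin n) → u ≡ x ⊎ (u ≢ x × v ≡ x) ⊎ (u ≢ x × v ≢ x)
touches x u v with u ≟ x | v ≟ x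
... | yes u≡x | _        = inj₁ u≡x
... | no u≢x  | yes v≡x  = inj₂ (inj₁ (u≢x , v≡x))
... | no u≢x  | no v≢x   = inj₂ (inj₂ (u≢x , v≢x))

module _ {n} (H : Graph n) (x : Fin n) (r : Fin n → Bool) where

  private
    rowAdj : Fin n → Fin n → Bool
    rowAdj u v with u ≟ x | v ≟ x
    ... | yes _ | yes _ = false
    ... | yes _ | no _  = r v
    ... | no _  | yes _ = r u
    ... | no _  | no _  = adj H u v

    rowAdj-sym : ∀ u v → rowAdj u v ≡ rowAdj v u
    rowAdj-sym u v with u ≟ x | v ≟ x
    ... | yes _ | yes _ = refl
    ... | yes _ | no _  = refl
    ... | no _  | yes _ = refl
    ... | no _  | no _  = symm H u v

    rowAdj-irrefl : ∀ u → rowAdj u u ≡ false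
    rowAdj-irrefl u with u ≟ x
    ... | yes _ = refl
    ... | no _  = irrefl H u

  setRow : Graph n
  setRow = record { adj = rowAdj ; symm = rowAdj-sym ; irrefl = rowAdj-irrefl }

  setRow-row : ∀ {v} → v ≢ x → adj setRow x v ≡ r v
  setRow-row {v} v≢x with x ≟ x | v ≟ x
  ... | yes _ | no _     = refl
  ... | yes _ | yes v≡x  = contradiction v≡x v≢x
  ... | no x≢x | _       = contradiction refl x≢x

  setRow-edge : ∀ {v} → Edge setRow x v → v ≢ x × r v ≡ true
  setRow-edge {v} xv = v≢x , trans (sym (setRow-row v≢x)) xv
    where
    v≢x : v ≢ x
    v≢x = ≢-sym (edge⇒≢ setRow {x} {v} xv)

  setRow-away : ∀ {u v} → u ≢ x → v ≢ x → adj setRow u v ≡ adj H u v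
  setRow-away {u} {v} u≢x v≢x with u ≟ x | v ≟ x
  ... | no _ | no _ = refl
  ... | yes u≡x | _ = contradiction u≡x u≢x
  ... | no _ | yes v≡x = contradiction v≡x v≢x

module _ {n} {H : Graph n} {x : Fin n} {r : Fin n → Bool} where

  setRow-hereditary : ∀ {W} →
    (∀ v → v ∈ W → r v ≡ false) ⊎ (∀ v → v ∈ W → v ≢ x → r v ≡ true) →
    HereditarilyIsolatedOrDominating H (W - x) → HereditarilyIsolatedOrDominating (setRow H x r) W
  setRow-hereditary status hereditary S S⊆W nonempty with x ∈? S | status
  ... | yes xS | inj₁ isolated = inj₁ (x , xS , λ u uS xu →
          contradiction (trans (sym (isolated u (S⊆W uS))) (proj₂ (setRow-edge H x r xu))) λ ())
  ... | yes xS | inj₂ dominating = inj₂ (x , xS , λ y yS y≢x →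
          trans (setRow-row H x r y≢x) (dominating y (S⊆W yS) y≢x))
  ... | no x∉S | _ = isolatedOrDominating-mono
          (λ uS vS uv → trans (sym (setRow-away H x r (≢x uS) (≢x vS))) uv)
          (λ uS vS uv → trans (setRow-away H x r (≢x uS) (≢x vS)) uv)
          (hereditary S (λ yS → x∈p∧x≢y⇒x∈p-y (S⊆W yS) (≢x yS)) nonempty)
    where
    ≢x : ∀ {y} → y ∈ S → y ≢ x
    ≢x yS refl = x∉S yS

module Completion {n k} (G : Graph n) (N : Fin k → Subset n) where

  Completes : Subset n → Graph n → Set
  Completes W H = IsEmbedding G N H × HereditarilyIsolatedOrDominating H W

  isEmbedding-refl : IsEmbedding G N G
  isEmbedding-refl = (λ _ _ uv → uv) , λ _ _ uv ¬uv → contradiction uv ¬uv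

  module _ {H : Graph n} {x : Fin n} {r : Fin n → Bool}
           (covers : ∀ v → Edge G x v → r v ≡ true)
           (justified : ∀ v → v ≢ x → r v ≡ true → ¬ Edge G x v → Shared N x v) where

    setRow-embedding : IsEmbedding G N H → IsEmbedding G N (setRow H x r)
    setRow-embedding (G⊆H , H⊆G∪N) = G⊆H′ , H′⊆G∪N
      where
      H′ : Graph n
      H′ = setRow H x r

      G⊆H′ : ∀ u v → Edge G u v → Edge H′ u v
      G⊆H′ u v uv with touches x u v
      ... | inj₁ refl = trans (setRow-row H x r (≢-sym (edge⇒≢ G uv))) (covers v uv)
      ... | inj₂ (inj₁ (u≢x , refl)) = adj-flip H′ {x} {u} (trans (setRow-row H x r u≢x) (covers u (adj-flip G uv)))
      ... | inj₂ (inj₂ (u≢x , v≢x)) = trans (setRow-away H x r u≢x v≢x) (G⊆H u v uv)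

      H′⊆G∪N : ∀ u v → Edge H′ u v → ¬ Edge G u v → Shared N u v
      H′⊆G∪N u v uv ¬uv with touches x u v
      ... | inj₁ refl = let v≢x , rv = setRow-edge H x r uv in justified v v≢x rv ¬uv
      ... | inj₂ (inj₁ (u≢x , refl)) =
        shared-sym (justified u u≢x (proj₂ (setRow-edge H x r (adj-flip H′ {u} {x} uv))) (¬uv ∘ adj-flip G))
      ... | inj₂ (inj₂ (u≢x , v≢x)) = H⊆G∪N u v (trans (sym (setRow-away H x r u≢x v≢x)) uv) ¬uv

  completion : IsolatedOrDominatingModulo G N → ∀ W → ∃[ H ] Completes W H
  completion split = All.wfRec ⊂-wellFounded 0ℓ (λ W → ∃[ H ] Completes W H) extend
    where
    extend : ∀ W → WfRec _⊂_ (λ W → ∃[ H ] Completes W H) W → ∃[ H ] Completes W H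
    extend W complete with nonempty? W
    ... | no empty = G , isEmbedding-refl , λ S S⊆W (s , sS) → contradiction (s , S⊆W sS) empty
    ... | yes nonempty with split W nonempty
    ... | inj₁ (x , xW , isolated) with complete (x∈p⇒p-x⊂p xW)
    ...   | H , embedding , hereditary =
      setRow H x (adj G x) ,
      setRow-embedding (λ _ xv → xv) (λ _ _ xv ¬xv → contradiction xv ¬xv) embedding ,
      setRow-hereditary (inj₁ λ v vW → nonEdge G (isolated v vW)) hereditary
    extend W complete | yes nonempty | inj₂ (x , xW , dominating) with complete (x∈p⇒p-x⊂p xW)
    ...   | H , embedding , hereditary =
      setRow H x row ,
      setRow-embedding covers justified embedding ,
      setRow-hereditary (inj₂ adjacent) hereditary
      where
      -- The second disjunct keeps the edges of G from x to vertices outside W.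
      row : Fin n → Bool
      row v = does (v ∈? W) ∨ adj G x v

      covers : ∀ v → Edge G x v → row v ≡ true
      covers v xv = trans (cong (does (v ∈? W) ∨_) xv) (Bool.∨-zeroʳ _)

      justified : ∀ v → v ≢ x → row v ≡ true → ¬ Edge G x v → Shared N x v
      justified v v≢x rv ¬xv with v ∈? W
      ... | no _ = contradiction rv ¬xv
      ... | yes vW with dominating v vW v≢x
      ...   | inj₁ xv = contradiction xv ¬xv
      ...   | inj₂ shared = shared

      adjacent : ∀ v → v ∈ W → v ≢ x → row v ≡ true
      adjacent v vW _ with v ∈? W
      ... | yes _ = refl
      ... | no v∉W = contradiction vW v∉W

padWithEmpty : ∀ {n j k} → j ≤ k → (N : Fin j → Subset n) → Σ (Fin k → Subset n) λ N′ →
  (∀ {u v} → Shared N u v → Shared N′ u v) ×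
  (∀ G → (∀ i → Independent G (N i)) → ∀ i′ → Independent G (N′ i′))
padWithEmpty {n} {j} {k} j≤k N with m≤n⇒∃[o]m+o≡n {j} {k} j≤k
... | d , refl = N′ , shared⁺ , independent⁺
  where
  N′ : Fin (j + d) → Subset n
  N′ i′ = [ N , const ⊥ ]′ (splitAt j i′)

  shared⁺ : ∀ {u v} → Shared N u v → Shared N′ u v
  shared⁺ {u} {v} (i , u∈ , v∈) = i ↑ˡ d , subst (u ∈_) N≡ u∈ , subst (v ∈_) N≡ v∈
    where
    N≡ : N i ≡ N′ (i ↑ˡ d)
    N≡ = sym (cong [ N , const ⊥ ]′ (splitAt-↑ˡ j i d))

  independent⁺ : ∀ G → (∀ i → Independent G (N i)) → ∀ i′ → Independent G (N′ i′)
  independent⁺ G independent i′ with splitAt j i′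
  ... | inj₁ i = independent i
  ... | inj₂ _ = λ _ _ u∈⊥ _ → contradiction u∈⊥ ∉⊥

embedding-edge : ∀ {n k} (G H : Graph n) {N : Fin k → Subset n} → IsEmbedding G N H →
  ∀ {u v} → Edge H u v → Edge G u v ⊎ Shared N u v
embedding-edge G H (_ , H⊆G∪N) {u} {v} uv with edge? G u v
... | yes uv′ = inj₁ uv′
... | no ¬uv = inj₂ (H⊆G∪N u v uv ¬uv)

mainTheorem6 : ∀ {n : ℕ} (G : Graph n) (k : ℕ) →
    ThresholdWidth≤ G k ⇔
      Σ (Fin k → Subset n) λ N → (∀ i → Independent G (N i)) ×
        (∀ (W : Subset n) → Nonempty W →
          (∃[ v ] (v ∈ W × (∀ u → u ∈ W → ¬ Edge G v u)))
          ⊎ (∃[ ω ] (ω ∈ W × (∀ y → y ∈ W → y ≢ ω →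
               Edge G ω y ⊎ ∃[ i ] (ω ∈ N i × y ∈ N i)))))
mainTheorem6 G k = mk⇔ from-embedding to-embedding
  where
  from-embedding : ThresholdWidth≤ G k →
    Σ (Fin k → Subset _) λ N → (∀ i → Independent G (N i)) × IsolatedOrDominatingModulo G N
  from-embedding (j , j≤k , N , independent , H , embedding , threshold)
    with padWithEmpty j≤k N
  ... | N′ , shared⁺ , independent⁺ =
    N′ , independent⁺ G independent , λ W nonempty →
      isolatedOrDominating-mono
        (λ _ _ → proj₁ embedding _ _)
        (λ _ _ → Sum.map₂ shared⁺ ∘ embedding-edge G H embedding)
        (threshold⇒hereditarilyIsolatedOrDominating H threshold W (λ _ → ∈⊤) nonempty)

  to-embedding : Σ (Fin k → Subset _) (λ N → (∀ i → Independent G (N i)) × IsolatedOrDominatingModulo G N) →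
    ThresholdWidth≤ G k
  to-embedding (N , independent , split) with Completion.completion G N split ⊤
  ... | H , embedding , hereditary =
    k , ≤-refl , N , independent , H , embedding ,
    hereditarilyIsolatedOrDominating⇒threshold H hereditary
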